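{- Let $s,t,n\in\mathbb{N}$ with $s\geq t\geq 2$ and $n\geq 2s+t-1$, and let $\mathcal{F}'=\mathcal{F}_1\cup\mathcal{F}_2\cup\mathcal{F}_3\cup\mathcal{F}_4\subseteq 2^{[n]}$ be as described in the context. Then $(\mathcal{F}',\subseteq)$ contains no induced copy of $\mathcal{K}_{s,t}$.
   Context: The complete bipartite poset $\mathcal{K}_{s,t}$ consists of $s$ pairwise incomparable elements (upper layer) and $t$ pairwise incomparable elements (lower layer), every upper element larger than every lower element, and no other relations. A poset $\mathcal{Q}$ contains an induced copy of $\mathcal{P}$ if there is an injective $f:\mathcal{P}\to\mathcal{Q}$ with $f(x)\preceq f(y)$ iff $x\preceq y$. For integers $m\le k$, $[m,k]=\{m,\dots,k\}$ and $[k]=[1,k]$; complements are taken in $[n]$, so $\{x\}^c=[n]\setminus\{x\}$; $\binom{A}{k}$ is the family of $k$-element subsets of $A$. For $A\subseteq B\subseteq[n]$, a chain from $A$ to $B$ is a family of sets listable as $A=C_0\subsetneq C_1\subsetneq\dots\subsetneq C_r=B$; it is complete if it has exactly $|B\setminus A|+1$ members; two chains from $A$ to $B$ are internally disjoint if their intersection is $\{A,B\}$. If $\mathcal{L}$ is the union (as a family of sets) of $k$ pairwise internally disjoint complete chains from $A$ to $B$ with $|B\setminus A|\ge k$, let $X_1,\dots,X_k$ be its $k$ distinct members of size $|A|+1$ and $Y_1,\dots,Y_k$ its $k$ distinct members of size $|B|-1$; the first increment set of $\mathcal{L}$ is $\bigcup_{i=1}^k X_i\setminus A$ and the last increment set is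 $B\setminus\bigcap_{i=1}^k Y_i$. For $A\subseteq[s+t]$: an upper $s$-lantern $\mathcal{L}^s(A)$ is a union of $s-1$ pairwise internally disjoint complete chains from $A$ to $A\cup[s+t+1,n]$ whose last increment set is $[s+t+1,2s+t-1]$; a lower $t$-lantern $\mathcal{L}_t(A)$ is a union of $t-1$ pairwise internally disjoint complete chains from $A$ to $A\cup[s+t+1,n]$ whose first increment set is $[s+t+1,s+2t-1]$. For each relevant $A$ one such lantern is fixed. Define $\mathcal{F}_1=\{[n]\}\cup\{\{x\}^c: x\in[s+t-1]\}$; $\mathcal{F}_2=\bigcup_{A\in\binom{[s+t-1]}{t}}\mathcal{L}^s(A)$; $\mathcal{F}_3=\bigcup_{A\in\binom{[s+t-1]}{t-1}}\mathcal{L}_t(A\cup\{s+t\})$; $\mathcal{F}_4=\{\emptyset\}\cup\{\{x\}:x\in[s+t-1]\}$; and $\mathcal{F}'=\mathcal{F}_1\cup\mathcal{F}_2\cup\mathcal{F}_3\cup\mathcal{F}_4$. -}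

module Defs where

open import Data.Nat using (ℕ; zero; suc; _+_; _∸_; _≤_; _≤ᵇ_)
open import Data.Bool using (Bool; _∧_)
open import Data.Fin using (Fin; toℕ; fromℕ; inject₁)
open import Data.Fin.Subset using (Subset; _∈_; _∉_; _⊆_; _⊂_; _∪_; _─_; ∁; ⊤; ⊥; ∣_∣)
open import Data.Vec using (tabulate)
open import Data.Sum using (_⊎_)
open import Data.Product using (Σ; ∃; _×_; Σ-syntax; ∃-syntax)
open import Data.Unit using () renaming (⊤ to Unit)
open import Data.Empty using () renaming (⊥ to Empty)
open import Function.Bundles using (_⇔_)
open import Function.Definitions using (Injective)
open import Relation.Binary.PropositionalEquality using (_≡_; _≢_)

-- Subsets of [n] = {1,…,n} are represented by 'Subset n'; the index i : Fin n
-- stands for the number  elt i = toℕ i + 1.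
elt : ∀ {n} → Fin n → ℕ
elt i = suc (toℕ i)

Itv : (n a b : ℕ) → Subset n
Itv n a b = tabulate (λ i → (a ≤ᵇ elt i) ∧ (elt i ≤ᵇ b))

Family : ℕ → Set₁
Family n = Subset n → Set

-- F is a chain from A to B that is complete: listable as
-- A = C₀ ⊊ C₁ ⊊ … ⊊ C_r = B with exactly |B∖A|+1 members (i.e. r = |B∖A|,
-- the listing being strictly increasing hence injective).
IsCompleteChain : ∀ {n} → Subset n → Subset n → Family n → Set
IsCompleteChain {n} A B F =
  Σ[ C ∈ (Fin (suc ∣ B ─ A ∣) → Subset n) ]
    ( (C Fin.zero ≡ A)
    × (C (fromℕ ∣ B ─ A ∣) ≡ B)
    × (∀ (i : Fin ∣ B ─ A ∣) → C (inject₁ i) ⊂ C (Fin.suc i))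
    × (∀ X → F X ⇔ (∃[ i ] (C i ≡ X))) )
  where import Data.Fin as Fin

InternallyDisjoint : ∀ {n} → Subset n → Subset n → Family n → Family n → Set
InternallyDisjoint A B F G = ∀ X → F X → G X → (X ≡ A) ⊎ (X ≡ B)

IsLanternUnion : ∀ {n} → ℕ → Subset n → Subset n → Family n → Set₁
IsLanternUnion {n} k A B L =
  (k ≤ ∣ B ─ A ∣)
  × Σ[ Ch ∈ (Fin k → Family n) ]
      ( (∀ i → IsCompleteChain A B (Ch i))
      × (∀ i j → i ≢ j → InternallyDisjoint A B (Ch i) (Ch j))
      × (∀ X → L X ⇔ (∃[ i ] (Ch i X))) )

-- x belongs to the first increment set  ⋃ (X_i ∖ A)  (X_i the members of size |A|+1)
InFirstIncrement : ∀ {n} → Subset n → Family n → Fin n → Set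
InFirstIncrement A L x = ∃[ X ] (L X × ∣ X ∣ ≡ suc ∣ A ∣ × x ∈ X × x ∉ A)

-- x belongs to the last increment set  B ∖ ⋂ Y_i  (Y_i the members of size |B|-1)
InLastIncrement : ∀ {n} → Subset n → Family n → Fin n → Set
InLastIncrement B L x = x ∈ B × ∃[ Y ] (L Y × suc ∣ Y ∣ ≡ ∣ B ∣ × x ∉ Y)

IsUpperLantern : (s t n : ℕ) → Subset n → Family n → Set₁
IsUpperLantern s t n A L =
  IsLanternUnion (s ∸ 1) A B L
  × (∀ x → InLastIncrement B L x ⇔ (x ∈ Itv n (s + t + 1) (2 * s + t ∸ 1)))
  where
    open import Data.Nat using (_*_)
    B = A ∪ Itv n (s + t + 1) n

IsLowerLantern : (s t n : ℕ) → Subset n → Family n → Set₁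
IsLowerLantern s t n A L =
  IsLanternUnion (t ∸ 1) A B L
  × (∀ x → InFirstIncrement A L x ⇔ (x ∈ Itv n (s + t + 1) (s + 2 * t ∸ 1)))
  where
    open import Data.Nat using (_*_)
    B = A ∪ Itv n (s + t + 1) n

-- the families F₁,…,F₄ and F', given the fixed choice of lanterns
-- (up A = L^s(A), low A = L_t(A))
F₁ : (s t n : ℕ) → Family n
F₁ s t n X = (X ≡ ⊤) ⊎ ∃[ x ] (1 ≤ x × x ≤ s + t ∸ 1 × X ≡ ∁ (Itv n x x))

F₂ : (s t n : ℕ) → (Subset n → Family n) → Family n
F₂ s t n up X = ∃[ A ] (A ⊆ Itv n 1 (s + t ∸ 1) × ∣ A ∣ ≡ t × up A X)

F₃ : (s t n : ℕ) → (Subset n → Family n) → Family n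
F₃ s t n low X =
  ∃[ A ] (A ⊆ Itv n 1 (s + t ∸ 1) × ∣ A ∣ ≡ t ∸ 1 × low (A ∪ Itv n (s + t) (s + t)) X)

F₄ : (s t n : ℕ) → Family n
F₄ s t n X = (X ≡ ⊥) ⊎ ∃[ x ] (1 ≤ x × x ≤ s + t ∸ 1 × X ≡ Itv n x x)

F′ : (s t n : ℕ) → (Subset n → Family n) → (Subset n → Family n) → Family n
F′ s t n up low X = F₁ s t n X ⊎ F₂ s t n up X ⊎ F₃ s t n low X ⊎ F₄ s t n X

data Kst (s t : ℕ) : Set where
  upper : Fin s → Kst s t
  lower : Fin t → Kst s t

_≼K_ : ∀ {s t} → Kst s t → Kst s t → Set
upper a ≼K upper b = a ≡ b
lower a ≼K lower b = a ≡ b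
lower _ ≼K upper _ = Unit
upper _ ≼K lower _ = Empty

InducedCopy : ∀ {n} {P : Set} → (P → P → Set) → Family n → Set
InducedCopy {n} {P} _≼_ F =
  Σ[ f ∈ (P → Subset n) ]
    ( (∀ x → F (f x))
    × Injective _≡_ _≡_ f
    × (∀ x y → (f x ⊆ f y) ⇔ (x ≼ y)) )

module Submission where

-- Let U₁,…,U_s and D₁,…,D_t be the layers of an induced K_{s,t} in F′. Incomparability
-- excludes [n] and ∅, singletons among the Uᵢ and complements of singletons among the D_j.
-- A member X of F₂ ∪ F₃ lies in a lantern whose base K (|K| = t) is X ∩ [s+t], so comparable
-- such members share their lantern, and a lantern of s − 1 chains (t − 1 when s+t ∈ K)
-- holds no antichain of size s (resp. t).
-- If some Uᵢ lies in a lantern with base K, every point of K lies in some D_j (a lantern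
-- member D_j shares the base; otherwise the t distinct singletons D_j fill K), which forces
-- every U into that lantern. Otherwise every Uᵢ is {xᵢ}ᶜ. If all D_j are singletons we get
-- s + t distinct points in [s+t−1]; if D_j lies in a lantern with base K, then K avoids the
-- xᵢ, so K ∪ {xᵢ} = [s+t], whence s+t ∈ K and every D lies in this lower lantern.

open import Defs
open import Data.Nat using (ℕ; zero; suc; _+_; _*_; _∸_; _≤_; _≤ᵇ_; z≤n; s≤s)
import Data.Nat.Properties as ℕ
open import Data.Nat.Tactic.RingSolver using (solve-∀)
open import Data.Bool using (Bool; _∧_)
open import Data.Bool.Properties using (T-≡; T-∧)
open import Data.Fin using (Fin; zero; suc; toℕ; fromℕ; fromℕ<; inject₁; splitAt; join)
import Data.Fin.Properties as FinP
open import Data.Fin.Subset using (Subset; _∈_; _∉_; _⊆_; _⊂_; _─_; _∪_; _-_; ∁; ⊤; ⊥; ∣_∣; ⁅_⁆; inside; outside)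
import Data.Fin.Subset.Properties as Sub
open import Data.Vec using ([]; _∷_; here; there)
open import Data.Vec.Properties using ([]=⇒lookup; lookup⇒[]=; lookup∘tabulate)
open import Data.Vec.Functional using (_++_) renaming (_∷_ to _∷ᶠ_)
open import Data.Vec.Functional.Relation.Unary.All.Properties using (++⁺)
open import Data.Sum using (_⊎_; inj₁; inj₂; [_,_]′)
open import Data.Unit using (tt)
open import Data.Product using (∃; _×_; _,_; proj₁; proj₂)
open import Data.Empty using (⊥-elim) renaming (⊥ to Empty)
open import Function using (_∘_)
open import Function.Bundles using (_⇔_; mk⇔; Equivalence)
open Equivalence using (to; from)
open import Function.Definitions using (Injective)
open import Relation.Nullary using (¬_; yes; no; contradiction)
open import Relation.Binary.PropositionalEquality using (_≡_; _≢_; refl; sym; trans; cong; cong₂; subst; module ≡-Reasoning)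

∈-Itv⇔ : ∀ {n a b} {i : Fin n} → i ∈ Itv n a b ⇔ (a ≤ elt i × elt i ≤ b)
∈-Itv⇔ {n} {a} {b} {i} = mk⇔ ⇒ ⇐
  where
  inItv : Fin n → Bool
  inItv j = (a ≤ᵇ elt j) ∧ (elt j ≤ᵇ b)
  ⇒ : i ∈ Itv n a b → a ≤ elt i × elt i ≤ b
  ⇒ h with to T-∧ (from T-≡ (trans (sym (lookup∘tabulate inItv i)) ([]=⇒lookup h)))
  ... | a≤ , ≤b = ℕ.≤ᵇ⇒≤ a (elt i) a≤ , ℕ.≤ᵇ⇒≤ (elt i) b ≤b
  ⇐ : a ≤ elt i × elt i ≤ b → i ∈ Itv n a b
  ⇐ (a≤ , ≤b) = lookup⇒[]= i _ (trans (lookup∘tabulate inItv i) (to T-≡ (from T-∧ (ℕ.≤⇒≤ᵇ a≤ , ℕ.≤⇒≤ᵇ ≤b))))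

elt-injective : ∀ {n} → Injective _≡_ _≡_ (elt {n})
elt-injective = FinP.toℕ-injective ∘ ℕ.suc-injective

elt⁻¹ : ∀ {n x} → 1 ≤ x → x ≤ n → ∃ λ (i : Fin n) → elt i ≡ x
elt⁻¹ {x = suc x} _ x≤n = fromℕ< x≤n , cong suc (FinP.toℕ-fromℕ< x≤n)

Itv-singleton : ∀ {n x} {i : Fin n} → elt i ≡ x → Itv n x x ≡ ⁅ i ⁆
Itv-singleton {n} {x} {i} refl = Sub.⊆-antisym ⊆⁅i⁆ ⁅i⁆⊆
  where
  ⊆⁅i⁆ : Itv n x x ⊆ ⁅ i ⁆
  ⊆⁅i⁆ {j} h with to ∈-Itv⇔ h
  ... | x≤j , j≤x = subst (_∈ ⁅ i ⁆) (sym (elt-injective (ℕ.≤-antisym j≤x x≤j))) (Sub.x∈⁅x⁆ i)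
  ⁅i⁆⊆ : ⁅ i ⁆ ⊆ Itv n x x
  ⁅i⁆⊆ {j} h rewrite Sub.x∈⁅y⁆⇒x≡y i h = from ∈-Itv⇔ (ℕ.≤-refl , ℕ.≤-refl)

injective⇒≤-bound : ∀ {m n N} (f : Fin m → Fin n) → Injective _≡_ _≡_ f →
  (∀ j → elt (f j) ≤ N) → m ≤ N
injective⇒≤-bound {m} {n} {N} f f-inj f≤N = FinP.injective⇒≤ g-inj
  where
  g : Fin m → Fin N
  g j = fromℕ< (f≤N j)
  g-inj : Injective _≡_ _≡_ g
  g-inj {i} {j} e = f-inj (FinP.toℕ-injective
    (trans (sym (FinP.toℕ-fromℕ< (f≤N i))) (trans (cong toℕ e) (FinP.toℕ-fromℕ< (f≤N j)))))

members : ∀ {n} (p : Subset n) → Fin ∣ p ∣ → Fin n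
members (inside ∷ p) zero = zero
members (inside ∷ p) (suc j) = suc (members p j)
members (outside ∷ p) j = suc (members p j)

members-∈ : ∀ {n} (p : Subset n) j → members p j ∈ p
members-∈ (inside ∷ p) zero = here
members-∈ (inside ∷ p) (suc j) = there (members-∈ p j)
members-∈ (outside ∷ p) j = there (members-∈ p j)

members-injective : ∀ {n} (p : Subset n) → Injective _≡_ _≡_ (members p)
members-injective (inside ∷ p) {zero} {zero} _ = refl
members-injective (inside ∷ p) {suc i} {suc j} e = cong suc (members-injective p (FinP.suc-injective e))
members-injective (outside ∷ p) e = members-injective p (FinP.suc-injective e)

++-injective : ∀ {a} {A : Set a} {m k} {f : Fin m → A} {g : Fin k → A} →
  Injective _≡_ _≡_ f → Injective _≡_ _≡_ g → (∀ i j → f i ≢ g j) → Injective _≡_ _≡_ (f ++ g)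
++-injective {m = m} {k} {f} {g} f-inj g-inj f≢g {i} {j} e =
  trans (sym (FinP.join-splitAt m k i)) (trans (cong (join m k) (split-inj (splitAt m i) (splitAt m j) e))
                                              (FinP.join-splitAt m k j))
  where
  split-inj : ∀ x y → [ f , g ]′ x ≡ [ f , g ]′ y → x ≡ y
  split-inj (inj₁ x) (inj₁ y) e = cong inj₁ (f-inj e)
  split-inj (inj₁ x) (inj₂ y) e = contradiction e (f≢g x y)
  split-inj (inj₂ x) (inj₁ y) e = contradiction (sym e) (f≢g y x)
  split-inj (inj₂ x) (inj₂ y) e = cong inj₂ (g-inj e)

count-outside : ∀ {m n N} (P : Subset n) (f : Fin m → Fin n) → Injective _≡_ _≡_ f →
  (∀ j → f j ∉ P) → (∀ j → elt (f j) ≤ N) → (∀ {i} → i ∈ P → elt i ≤ N) → m + ∣ P ∣ ≤ N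
count-outside {N = N} P f f-inj f∉P f≤N P≤N =
  injective⇒≤-bound (f ++ members P) (++-injective f-inj (members-injective P) f≢P)
    (++⁺ (λ i → elt i ≤ N) f≤N (P≤N ∘ members-∈ P))
  where
  f≢P : ∀ i j → f i ≢ members P j
  f≢P i j e = f∉P i (subst (_∈ P) (sym e) (members-∈ P j))

injective-into⇒≤∣_∣ : ∀ {m n} (P : Subset n) (f : Fin m → Fin n) → Injective _≡_ _≡_ f →
  (∀ j → f j ∈ P) → m ≤ ∣ P ∣
injective-into⇒≤∣_∣ {m} {n} P f f-inj f∈P = ℕ.+-cancelˡ-≤ (n ∸ ∣ P ∣) m ∣ P ∣ (begin
  n ∸ ∣ P ∣ + m     ≡⟨ cong (_+ m) (sym (Sub.∣∁p∣≡n∸∣p∣ P)) ⟩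
  ∣ ∁ P ∣ + m       ≡⟨ ℕ.+-comm ∣ ∁ P ∣ m ⟩
  m + ∣ ∁ P ∣       ≤⟨ count-outside (∁ P) f f-inj (Sub.x∈p⇒x∉∁p ∘ f∈P) (FinP.toℕ<n ∘ f) (λ {i} _ → FinP.toℕ<n i) ⟩
  n                 ≡⟨ sym (ℕ.m∸n+n≡m (Sub.∣p∣≤n P)) ⟩
  n ∸ ∣ P ∣ + ∣ P ∣ ∎)
  where open ℕ.≤-Reasoning

p⊆q⇒∣p∣≡∣q∣⇒p≡q : ∀ {n} {p q : Subset n} → p ⊆ q → ∣ p ∣ ≡ ∣ q ∣ → p ≡ q
p⊆q⇒∣p∣≡∣q∣⇒p≡q {p = p} {q} p⊆q ∣p∣≡∣q∣ = Sub.⊆-antisym p⊆q q⊆p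
  where
  q⊆p : q ⊆ p
  q⊆p {x} x∈q with x Sub.∈? p
  ... | yes x∈p = x∈p
  ... | no x∉p = contradiction ∣p∣≡∣q∣ (ℕ.<⇒≢ (Sub.p⊂q⇒∣p∣<∣q∣ (p⊆q , x , x∈q , x∉p)))

∣p∪q∣≡∣p∣+∣q∣ : ∀ {n} (p q : Subset n) → (∀ {x} → x ∈ p → x ∉ q) → ∣ p ∪ q ∣ ≡ ∣ p ∣ + ∣ q ∣
∣p∪q∣≡∣p∣+∣q∣ [] [] _ = refl
∣p∪q∣≡∣p∣+∣q∣ (inside ∷ p) (inside ∷ q) disj = contradiction here (disj here)
∣p∪q∣≡∣p∣+∣q∣ (inside ∷ p) (outside ∷ q) disj = cong suc (∣p∪q∣≡∣p∣+∣q∣ p q (λ x∈p x∈q → disj (there x∈p) (there x∈q)))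
∣p∪q∣≡∣p∣+∣q∣ (outside ∷ p) (inside ∷ q) disj =
  trans (cong suc (∣p∪q∣≡∣p∣+∣q∣ p q (λ x∈p x∈q → disj (there x∈p) (there x∈q)))) (sym (ℕ.+-suc ∣ p ∣ ∣ q ∣))
∣p∪q∣≡∣p∣+∣q∣ (outside ∷ p) (outside ∷ q) disj = ∣p∪q∣≡∣p∣+∣q∣ p q (λ x∈p x∈q → disj (there x∈p) (there x∈q))

Comparable : ∀ {n} → Subset n → Subset n → Set
Comparable p q = p ⊆ q ⊎ q ⊆ p

⊆⁅x⁆⇒comparable : ∀ {n} {x : Fin n} {p q : Subset n} → p ⊆ ⁅ x ⁆ → q ⊆ ⁅ x ⁆ → Comparable p q
⊆⁅x⁆⇒comparable {x = x} {p} {q} p⊆x q⊆x with x Sub.∈? q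
... | yes x∈q = inj₁ λ {y} y∈p → subst (_∈ q) (sym (Sub.x∈⁅y⁆⇒x≡y x (p⊆x y∈p))) x∈q
... | no x∉q = inj₂ λ {y} y∈q → contradiction (subst (_∈ q) (Sub.x∈⁅y⁆⇒x≡y x (q⊆x y∈q)) y∈q) x∉q

∁⁅x⁆⊆⇒comparable : ∀ {n} {x : Fin n} {p q : Subset n} → ∁ ⁅ x ⁆ ⊆ p → ∁ ⁅ x ⁆ ⊆ q → Comparable p q
∁⁅x⁆⊆⇒comparable {x = x} {p} {q} x⊆p x⊆q with x Sub.∈? p
... | yes x∈p = inj₂ q⊆p
  where
  q⊆p : q ⊆ p
  q⊆p {y} y∈q with y FinP.≟ x
  ... | yes refl = x∈p
  ... | no y≢x = x⊆p (Sub.x∉p⇒x∈∁p (Sub.x≢y⇒x∉⁅y⁆ y≢x))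
... | no x∉p = inj₁ λ {y} y∈p →
  x⊆q (Sub.x∉p⇒x∈∁p (Sub.x≢y⇒x∉⁅y⁆ λ { refl → x∉p y∈p }))

Antichain : ∀ {m n} → (Fin m → Subset n) → Set
Antichain f = ∀ i j → f i ⊆ f j → i ≡ j

antichain⇒incomparable : ∀ {m n} {f : Fin m → Subset n} → Antichain f → ∀ {i j} → i ≢ j → ¬ Comparable (f i) (f j)
antichain⇒incomparable anti i≢j (inj₁ fi⊆fj) = i≢j (anti _ _ fi⊆fj)
antichain⇒incomparable anti i≢j (inj₂ fj⊆fi) = i≢j (sym (anti _ _ fj⊆fi))

antichain-labels-injective : ∀ {m n} {A : Set} {F : Fin m → Subset n} (g : A → Subset n) (label : Fin m → A) →
  Antichain F → (∀ j → F j ≡ g (label j)) → Injective _≡_ _≡_ label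
antichain-labels-injective g label anti F≡ {i} {j} e =
  anti i j (Sub.⊆-reflexive (trans (F≡ i) (trans (cong g e) (sym (F≡ j)))))

x∉∁⁅x⁆ : ∀ {n} {x : Fin n} → x ∉ ∁ ⁅ x ⁆
x∉∁⁅x⁆ {x = x} x∈ = Sub.x∈∁p⇒x∉p x∈ (Sub.x∈⁅x⁆ x)

another : ∀ {m} → 2 ≤ m → (i : Fin m) → ∃ λ j → i ≢ j
another (s≤s (s≤s _)) zero = suc zero , λ ()
another (s≤s (s≤s _)) (suc i) = zero , λ ()

module _ {n r} (C : Fin (suc r) → Subset n) (step : ∀ (i : Fin r) → C (inject₁ i) ⊂ C (suc i)) where

  private
    ⊆-at-distance : ∀ d {i j} → toℕ j ≡ d + toℕ i → C i ⊆ C j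
    ⊆-at-distance zero e = Sub.⊆-reflexive (cong C (FinP.toℕ-injective (sym e)))
    ⊆-at-distance (suc d) {j = zero} ()
    ⊆-at-distance (suc d) {j = suc j} e x∈Ci =
      proj₁ (step j) (⊆-at-distance d (trans (FinP.toℕ-inject₁ j) (ℕ.suc-injective e)) x∈Ci)

  strictChain-monotone : ∀ {i j} → toℕ i ≤ toℕ j → C i ⊆ C j
  strictChain-monotone i≤j = ⊆-at-distance _ (sym (ℕ.m∸n+n≡m i≤j))

completeChain-comparable : ∀ {n} {A B : Subset n} {F : Family n} → IsCompleteChain A B F →
  ∀ {X Y} → F X → F Y → Comparable X Y
completeChain-comparable (C , _ , _ , step , F⇔C) {X} {Y} X∈F Y∈F
  with to (F⇔C X) X∈F | to (F⇔C Y) Y∈F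
... | i , refl | j , refl with ℕ.≤-total (toℕ i) (toℕ j)
...   | inj₁ i≤j = inj₁ (strictChain-monotone C step i≤j)
...   | inj₂ j≤i = inj₂ (strictChain-monotone C step j≤i)

completeChain-bounds : ∀ {n} {A B : Subset n} {F : Family n} → IsCompleteChain A B F →
  ∀ {X} → F X → A ⊆ X × X ⊆ B
completeChain-bounds {A = A} {B} (C , C₀≡A , Cᵣ≡B , step , F⇔C) {X} X∈F with to (F⇔C X) X∈F
... | i , refl =
  (λ x∈A → strictChain-monotone C step z≤n (subst (_ ∈_) (sym C₀≡A) x∈A)) ,
  (λ x∈Ci → subst (_ ∈_) Cᵣ≡B (strictChain-monotone C step i≤r x∈Ci))
  where
  i≤r : toℕ i ≤ toℕ (fromℕ ∣ B ─ A ∣)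
  i≤r = subst (toℕ i ≤_) (sym (FinP.toℕ-fromℕ _)) (FinP.toℕ≤pred[n] i)

lantern-bounds : ∀ {n k} {A B : Subset n} {L : Family n} → IsLanternUnion k A B L →
  ∀ {X} → L X → A ⊆ X × X ⊆ B
lantern-bounds (_ , Ch , chains , _ , L⇔Ch) {X} X∈L with to (L⇔Ch X) X∈L
... | i , X∈Chᵢ = completeChain-bounds (chains i) X∈Chᵢ

lantern-antichain-≤ : ∀ {n k m} {A B : Subset n} {L : Family n} → IsLanternUnion k A B L →
  (f : Fin m → Subset n) → (∀ j → L (f j)) → Antichain f → m ≤ k
lantern-antichain-≤ (_ , Ch , chains , _ , L⇔Ch) f f∈L anti = FinP.injective⇒≤ chainOf-injective
  where
  chainOf : Fin _ → Fin _
  chainOf j = proj₁ (to (L⇔Ch (f j)) (f∈L j))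
  f∈chainOf : ∀ j → Ch (chainOf j) (f j)
  f∈chainOf j = proj₂ (to (L⇔Ch (f j)) (f∈L j))
  chainOf-injective : Injective _≡_ _≡_ chainOf
  chainOf-injective {i} {j} e with completeChain-comparable (chains (chainOf j))
                                      (subst (λ c → Ch c (f i)) e (f∈chainOf i)) (f∈chainOf j)
  ... | inj₁ fi⊆fj = anti i j fi⊆fj
  ... | inj₂ fj⊆fi = sym (anti j i fj⊆fi)

∷ᶠ-injective : ∀ {a} {A : Set a} {m} {x : A} {f : Fin m → A} →
  (∀ j → x ≢ f j) → Injective _≡_ _≡_ f → Injective _≡_ _≡_ (x ∷ᶠ f)
∷ᶠ-injective x≢f f-inj {zero} {zero} _ = refl
∷ᶠ-injective x≢f f-inj {zero} {suc j} e = contradiction e (x≢f j)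
∷ᶠ-injective x≢f f-inj {suc i} {zero} e = contradiction (sym e) (x≢f i)
∷ᶠ-injective x≢f f-inj {suc i} {suc j} e = cong suc (f-inj e)

some-or-all : ∀ {ℓ ℓ′ m} {P : Fin m → Set ℓ} {Q : Fin m → Set ℓ′} → (∀ i → P i ⊎ Q i) → ∃ P ⊎ (∀ i → Q i)
some-or-all {m = zero} _ = inj₂ λ ()
some-or-all {m = suc m} P⊎Q with P⊎Q zero | some-or-all (P⊎Q ∘ suc)
... | inj₁ p | _ = inj₁ (zero , p)
... | inj₂ _ | inj₁ (i , p) = inj₁ (suc i , p)
... | inj₂ q | inj₂ qs = inj₂ λ { zero → q ; (suc i) → qs i }

n≰n∸1 : ∀ {n} → 1 ≤ n → ¬ n ≤ n ∸ 1
n≰n∸1 {suc n} _ = ℕ.1+n≰n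

module Kst-free (s t n : ℕ) (2≤t : 2 ≤ t) (t≤s : t ≤ s) (n-large : 2 * s + t ∸ 1 ≤ n)
  (up low : Subset n → Family n)
  (up-lantern : ∀ A → A ⊆ Itv n 1 (s + t ∸ 1) → ∣ A ∣ ≡ t → IsUpperLantern s t n A (up A))
  (low-lantern : ∀ A → A ⊆ Itv n 1 (s + t ∸ 1) → ∣ A ∣ ≡ t ∸ 1 →
    IsLowerLantern s t n (A ∪ Itv n (s + t) (s + t)) (low (A ∪ Itv n (s + t) (s + t)))) where

  1≤t : 1 ≤ t
  1≤t = ℕ.≤-trans (s≤s z≤n) 2≤t

  2≤s : 2 ≤ s
  2≤s = ℕ.≤-trans 2≤t t≤s

  1≤s : 1 ≤ s
  1≤s = ℕ.≤-trans (s≤s z≤n) 2≤s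

  1≤s+t : 1 ≤ s + t
  1≤s+t = ℕ.≤-trans 1≤t (ℕ.m≤n+m t s)

  s+t≤n : s + t ≤ n
  s+t≤n = ℕ.≤-trans (ℕ.m+n≤o⇒m≤o∸n (s + t) (begin
    s + t + 1  ≤⟨ ℕ.+-monoʳ-≤ (s + t) 1≤s ⟩
    s + t + s  ≡⟨ twice s t ⟩
    2 * s + t  ∎)) n-large
    where
    open ℕ.≤-Reasoning
    twice : ∀ s t → s + t + s ≡ 2 * s + t
    twice = solve-∀

  Small : Fin n → Set
  Small i = elt i ≤ s + t ∸ 1

  R : Subset n
  R = Itv n (s + t + 1) n

  pivot : Fin n
  pivot = proj₁ (elt⁻¹ 1≤s+t s+t≤n)

  elt-pivot : elt pivot ≡ s + t
  elt-pivot = proj₂ (elt⁻¹ 1≤s+t s+t≤n)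

  pivot-not-small : ¬ Small pivot
  pivot-not-small small = n≰n∸1 1≤s+t (subst (_≤ s + t ∸ 1) elt-pivot small)

  small⇒≤ : ∀ {i} → Small i → elt i ≤ s + t
  small⇒≤ = ℕ.≤pred⇒≤

  ≤⇒∉R : ∀ {i} → elt i ≤ s + t → i ∉ R
  ≤⇒∉R i≤s+t i∈R = ℕ.m+1+n≰m (s + t) (ℕ.≤-trans (proj₁ (to (∈-Itv⇔ {a = s + t + 1} {b = n}) i∈R)) i≤s+t)

  -- The lantern of F₂ ∪ F₃ with base K: F₃-bases are exactly those containing s + t.
  KeyLantern : Subset n → Family n
  KeyLantern K X = (pivot ∉ K × up K X) ⊎ (pivot ∈ K × low K X)

  -- X lies in a lantern of F₂ ∪ F₃; its key, the base of that lantern, is X ∩ [s+t] (see ∈key).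
  record Keyed (X : Subset n) : Set₁ where
    field
      key : Subset n
      ∣key∣≡t : ∣ key ∣ ≡ t
      key-low : ∀ {i} → i ∈ key → elt i ≤ s + t
      up-lantern-of : pivot ∉ key → IsLanternUnion (s ∸ 1) key (key ∪ R) (up key)
      low-lantern-of : pivot ∈ key → IsLanternUnion (t ∸ 1) key (key ∪ R) (low key)
      member : KeyLantern key X

  open Keyed

  keyLantern-bounds : ∀ {X} (M : Keyed X) → ∀ {Y} → KeyLantern (key M) Y → key M ⊆ Y × Y ⊆ key M ∪ R
  keyLantern-bounds M (inj₁ (pivot∉ , Y∈)) = lantern-bounds (up-lantern-of M pivot∉) Y∈
  keyLantern-bounds M (inj₂ (pivot∈ , Y∈)) = lantern-bounds (low-lantern-of M pivot∈) Y∈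

  key⊆ : ∀ {X} (M : Keyed X) → key M ⊆ X
  key⊆ M = proj₁ (keyLantern-bounds M (member M))

  ∈key : ∀ {X} (M : Keyed X) {i} → i ∈ X → elt i ≤ s + t → i ∈ key M
  ∈key M {i} i∈X i≤s+t with Sub.x∈p∪q⁻ (key M) R (proj₂ (keyLantern-bounds M (member M)) i∈X)
  ... | inj₁ i∈key = i∈key
  ... | inj₂ i∈R = contradiction i∈R (≤⇒∉R i≤s+t)

  ⊆⇒key≡ : ∀ {X Y} (MX : Keyed X) (MY : Keyed Y) → X ⊆ Y → key MX ≡ key MY
  ⊆⇒key≡ MX MY X⊆Y = p⊆q⇒∣p∣≡∣q∣⇒p≡q (λ i∈ → ∈key MY (X⊆Y (key⊆ MX i∈)) (key-low MX i∈))
                                      (trans (∣key∣≡t MX) (sym (∣key∣≡t MY)))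

  ⊆key⇒KeyLantern : ∀ {X K} (M : Keyed X) → ∣ K ∣ ≡ t → K ⊆ key M → KeyLantern K X
  ⊆key⇒KeyLantern M ∣K∣≡t K⊆ =
    subst (λ K → KeyLantern K _) (sym (p⊆q⇒∣p∣≡∣q∣⇒p≡q K⊆ (trans ∣K∣≡t (sym (∣key∣≡t M))))) (member M)

  key⊆⇒KeyLantern : ∀ {X K} (M : Keyed X) → ∣ K ∣ ≡ t → key M ⊆ K → KeyLantern K X
  key⊆⇒KeyLantern M ∣K∣≡t ⊆K =
    subst (λ K → KeyLantern K _) (p⊆q⇒∣p∣≡∣q∣⇒p≡q ⊆K (trans (∣key∣≡t M) (sym ∣K∣≡t))) (member M)

  KeyLantern-antichain-≤-pivot : ∀ {X m} (M : Keyed X) → pivot ∈ key M → (f : Fin m → Subset n) →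
    (∀ j → KeyLantern (key M) (f j)) → Antichain f → m ≤ t ∸ 1
  KeyLantern-antichain-≤-pivot M pivot∈ f f∈ anti = lantern-antichain-≤ (low-lantern-of M pivot∈) f low∈ anti
    where
    low∈ : ∀ j → low (key M) (f j)
    low∈ j with f∈ j
    ... | inj₁ (pivot∉ , _) = contradiction pivot∈ pivot∉
    ... | inj₂ (_ , fj∈) = fj∈

  KeyLantern-antichain-≤ : ∀ {X m} (M : Keyed X) (f : Fin m → Subset n) →
    (∀ j → KeyLantern (key M) (f j)) → Antichain f → m ≤ s ∸ 1
  KeyLantern-antichain-≤ M f f∈ anti with pivot Sub.∈? key M
  ... | yes pivot∈ = ℕ.≤-trans (KeyLantern-antichain-≤-pivot M pivot∈ f f∈ anti) (ℕ.∸-monoˡ-≤ 1 t≤s)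
  ... | no pivot∉ = lantern-antichain-≤ (up-lantern-of M pivot∉) f up∈ anti
    where
    up∈ : ∀ j → up (key M) (f j)
    up∈ j with f∈ j
    ... | inj₁ (_ , fj∈) = fj∈
    ... | inj₂ (pivot∈ , _) = contradiction pivot∈ pivot∉

  small-of-Itv : ∀ {A i} → A ⊆ Itv n 1 (s + t ∸ 1) → i ∈ A → Small i
  small-of-Itv A⊆ i∈A = proj₂ (to (∈-Itv⇔ {a = 1}) (A⊆ i∈A))

  F₂⇒Keyed : ∀ {X} → F₂ s t n up X → Keyed X
  F₂⇒Keyed (A , A⊆ , ∣A∣≡t , X∈up) = record
    { key = A
    ; ∣key∣≡t = ∣A∣≡t
    ; key-low = small⇒≤ ∘ small-of-Itv A⊆
    ; up-lantern-of = λ _ → proj₁ (up-lantern A A⊆ ∣A∣≡t)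
    ; low-lantern-of = λ pivot∈A → contradiction (small-of-Itv A⊆ pivot∈A) pivot-not-small
    ; member = inj₁ (pivot-not-small ∘ small-of-Itv A⊆ , X∈up)
    }

  E : Subset n
  E = Itv n (s + t) (s + t)

  E≡⁅pivot⁆ : E ≡ ⁅ pivot ⁆
  E≡⁅pivot⁆ = Itv-singleton elt-pivot

  ∈E⇒≡pivot : ∀ {i} → i ∈ E → i ≡ pivot
  ∈E⇒≡pivot i∈E = Sub.x∈⁅y⁆⇒x≡y pivot (subst (_ ∈_) E≡⁅pivot⁆ i∈E)

  F₃⇒Keyed : ∀ {X} → F₃ s t n low X → Keyed X
  F₃⇒Keyed (A , A⊆ , ∣A∣≡t∸1 , X∈low) = record
    { key = A ∪ E
    ; ∣key∣≡t = ∣A∪E∣≡t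
    ; key-low = low-part
    ; up-lantern-of = λ pivot∉ → contradiction pivot∈ pivot∉
    ; low-lantern-of = λ _ → proj₁ (low-lantern A A⊆ ∣A∣≡t∸1)
    ; member = inj₂ (pivot∈ , X∈low)
    }
    where
    pivot∈ : pivot ∈ A ∪ E
    pivot∈ = Sub.q⊆p∪q A E (subst (pivot ∈_) (sym E≡⁅pivot⁆) (Sub.x∈⁅x⁆ pivot))
    A∩E-empty : ∀ {i} → i ∈ A → i ∉ E
    A∩E-empty i∈A i∈E = pivot-not-small (subst Small (∈E⇒≡pivot i∈E) (small-of-Itv A⊆ i∈A))
    ∣A∪E∣≡t : ∣ A ∪ E ∣ ≡ t
    ∣A∪E∣≡t = begin
      ∣ A ∪ E ∣        ≡⟨ ∣p∪q∣≡∣p∣+∣q∣ A E A∩E-empty ⟩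
      ∣ A ∣ + ∣ E ∣    ≡⟨ cong₂ _+_ ∣A∣≡t∸1 (trans (cong ∣_∣ E≡⁅pivot⁆) (Sub.∣⁅x⁆∣≡1 pivot)) ⟩
      t ∸ 1 + 1        ≡⟨ ℕ.m∸n+n≡m 1≤t ⟩
      t                ∎
      where open ≡-Reasoning
    low-part : ∀ {i} → i ∈ A ∪ E → elt i ≤ s + t
    low-part i∈ with Sub.x∈p∪q⁻ A E i∈
    ... | inj₁ i∈A = small⇒≤ (small-of-Itv A⊆ i∈A)
    ... | inj₂ i∈E = ℕ.≤-reflexive (trans (cong elt (∈E⇒≡pivot i∈E)) elt-pivot)

  Cosingleton : Subset n → Set
  Cosingleton X = ∃ λ i → Small i × X ≡ ∁ ⁅ i ⁆

  Singleton : Subset n → Set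
  Singleton X = ∃ λ i → Small i × X ≡ ⁅ i ⁆

  Itv-small-singleton : ∀ {x} → 1 ≤ x → x ≤ s + t ∸ 1 → ∃ λ i → Small i × Itv n x x ≡ ⁅ i ⁆
  Itv-small-singleton 1≤x x≤ with elt⁻¹ 1≤x (ℕ.≤-trans x≤ (ℕ.≤-trans (ℕ.m∸n≤m (s + t) 1) s+t≤n))
  ... | i , refl = i , x≤ , Itv-singleton refl

  data Shape (X : Subset n) : Set₁ where
    full : X ≡ ⊤ → Shape X
    cosingleton : Cosingleton X → Shape X
    keyed : Keyed X → Shape X
    empty : X ≡ ⊥ → Shape X
    singleton : Singleton X → Shape X

  shape : ∀ {X} → F′ s t n up low X → Shape X
  shape (inj₁ (inj₁ X≡⊤)) = full X≡⊤
  shape (inj₁ (inj₂ (x , 1≤x , x≤ , X≡))) with Itv-small-singleton 1≤x x≤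
  ... | i , small , Itv≡ = cosingleton (i , small , trans X≡ (cong ∁ Itv≡))
  shape (inj₂ (inj₁ X∈F₂)) = keyed (F₂⇒Keyed X∈F₂)
  shape (inj₂ (inj₂ (inj₁ X∈F₃))) = keyed (F₃⇒Keyed X∈F₃)
  shape (inj₂ (inj₂ (inj₂ (inj₁ X≡⊥)))) = empty X≡⊥
  shape (inj₂ (inj₂ (inj₂ (inj₂ (y , 1≤y , y≤ , X≡))))) with Itv-small-singleton 1≤y y≤
  ... | i , small , Itv≡ = singleton (i , small , trans X≡ Itv≡)

  module KstCopy
    (U : Fin s → Subset n) (D : Fin t → Subset n)
    (U-antichain : Antichain U) (D-antichain : Antichain D)
    (D⊆U : ∀ a b → D b ⊆ U a) (U⊈D : ∀ a b → ¬ U a ⊆ D b)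
    (U∈F′ : ∀ a → F′ s t n up low (U a)) (D∈F′ : ∀ b → F′ s t n up low (D b)) where

    someUpper : Fin s
    someUpper = fromℕ< 1≤s

    someLower : Fin t
    someLower = fromℕ< 1≤t

    upperShape : ∀ a → Keyed (U a) ⊎ Cosingleton (U a)
    upperShape a with shape (U∈F′ a) | another 2≤s a
    ... | full Ua≡⊤ | a′ , a≢a′ =
      ⊥-elim (antichain⇒incomparable U-antichain a≢a′ (inj₂ (subst (U a′ ⊆_) (sym Ua≡⊤) Sub.⊆⊤)))
    ... | cosingleton Ua-co | _ = inj₂ Ua-co
    ... | keyed Ma | _ = inj₁ Ma
    ... | empty Ua≡⊥ | a′ , a≢a′ =
      ⊥-elim (antichain⇒incomparable U-antichain a≢a′ (inj₁ (subst (_⊆ U a′) (sym Ua≡⊥) (Sub.⊆-min (U a′)))))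
    ... | singleton (i , _ , Ua≡⁅i⁆) | _ with another 2≤t someLower
    ...   | b′ , b≢b′ = ⊥-elim (antichain⇒incomparable D-antichain b≢b′ (⊆⁅x⁆⇒comparable (below someLower) (below b′)))
      where
      below : ∀ b → D b ⊆ ⁅ i ⁆
      below b = subst (D b ⊆_) Ua≡⁅i⁆ (D⊆U a b)

    lowerShape : ∀ b → Keyed (D b) ⊎ Singleton (D b)
    lowerShape b with shape (D∈F′ b) | another 2≤t b
    ... | full Db≡⊤ | _ = ⊥-elim (U⊈D someUpper b (subst (U someUpper ⊆_) (sym Db≡⊤) Sub.⊆⊤))
    ... | cosingleton (i , _ , Db≡∁⁅i⁆) | _ with another 2≤s someUpper
    ...   | a′ , a≢a′ = ⊥-elim (antichain⇒incomparable U-antichain a≢a′ (∁⁅x⁆⊆⇒comparable (above someUpper) (above a′)))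
      where
      above : ∀ a → ∁ ⁅ i ⁆ ⊆ U a
      above a = subst (_⊆ U a) Db≡∁⁅i⁆ (D⊆U a b)
    lowerShape b | keyed Mb | _ = inj₁ Mb
    lowerShape b | empty Db≡⊥ | b′ , b≢b′ =
      ⊥-elim (antichain⇒incomparable D-antichain b≢b′ (inj₁ (subst (_⊆ D b′) (sym Db≡⊥) (Sub.⊆-min (D b′)))))
    lowerShape b | singleton Db-single | _ = inj₂ Db-single

    Covered : Subset n → Set
    Covered K = ∀ {i} → i ∈ K → ∃ λ b → i ∈ D b

    keyed-upper-covered⇒⊥ : ∀ {a₀} (M₀ : Keyed (U a₀)) → Covered (key M₀) → Empty
    keyed-upper-covered⇒⊥ {a₀} M₀ covered =
      n≰n∸1 1≤s (KeyLantern-antichain-≤ M₀ U uppers-in U-antichain)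
      where
      uppers-in : ∀ a → KeyLantern (key M₀) (U a)
      uppers-in a with upperShape a
      ... | inj₁ Ma = ⊆key⇒KeyLantern Ma (∣key∣≡t M₀) λ i∈K₀ →
        let (b , i∈Db) = covered i∈K₀ in ∈key Ma (D⊆U a b i∈Db) (key-low M₀ i∈K₀)
      ... | inj₂ (x , x-small , Ua≡∁⁅x⁆) =
        subst (λ a → KeyLantern (key M₀) (U a)) (U-antichain a₀ a Ua₀⊆Ua) (member M₀)
        where
        x∉Ua₀ : x ∉ U a₀
        x∉Ua₀ x∈Ua₀ with covered (∈key M₀ x∈Ua₀ (small⇒≤ x-small))
        ... | b , x∈Db = x∉∁⁅x⁆ (subst (x ∈_) Ua≡∁⁅x⁆ (D⊆U a b x∈Db))
        Ua₀⊆Ua : U a₀ ⊆ U a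
        Ua₀⊆Ua j∈Ua₀ = subst (_ ∈_) (sym Ua≡∁⁅x⁆) (Sub.x∉p⇒x∈∁p (Sub.x≢y⇒x∉⁅y⁆ λ { refl → x∉Ua₀ j∈Ua₀ }))

    covered-by-keyed-lower : ∀ {a₀ b} (M₀ : Keyed (U a₀)) → Keyed (D b) → Covered (key M₀)
    covered-by-keyed-lower {a₀} {b} M₀ Mb i∈K₀ =
      b , key⊆ Mb (subst (_ ∈_) (sym (⊆⇒key≡ Mb M₀ (D⊆U a₀ b))) i∈K₀)

    module Lowers (ys : ∀ b → Singleton (D b)) where

      y : Fin t → Fin n
      y b = proj₁ (ys b)

      y-small : ∀ b → Small (y b)
      y-small b = proj₁ (proj₂ (ys b))

      y-injective : Injective _≡_ _≡_ y
      y-injective = antichain-labels-injective ⁅_⁆ y D-antichain (proj₂ ∘ proj₂ ∘ ys)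

      y∈D : ∀ b → y b ∈ D b
      y∈D b = subst (y b ∈_) (sym (proj₂ (proj₂ (ys b)))) (Sub.x∈⁅x⁆ (y b))

      covered-by-singletons : ∀ {a₀} (M₀ : Keyed (U a₀)) → Covered (key M₀)
      covered-by-singletons {a₀} M₀ {i} i∈K₀ with FinP.any? (λ b → y b FinP.≟ i)
      ... | yes (b , refl) = b , y∈D b
      ... | no y≢i = ⊥-elim (ℕ.<-irrefl (sym (∣key∣≡t M₀)) (ℕ.≤-<-trans t≤∣K₀-i∣ (Sub.x∈p⇒∣p-x∣<∣p∣ i∈K₀)))
        where
        t≤∣K₀-i∣ : t ≤ ∣ key M₀ - i ∣
        t≤∣K₀-i∣ = injective-into⇒≤∣ key M₀ - i ∣ y y-injective λ b →
          Sub.x∈p∧x≢y⇒x∈p-y (∈key M₀ (D⊆U a₀ b (y∈D b)) (small⇒≤ (y-small b))) (λ e → y≢i (b , e))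

    module Uppers (xs : ∀ a → Cosingleton (U a)) where

      x : Fin s → Fin n
      x a = proj₁ (xs a)

      x-small : ∀ a → Small (x a)
      x-small a = proj₁ (proj₂ (xs a))

      x-injective : Injective _≡_ _≡_ x
      x-injective = antichain-labels-injective (∁ ∘ ⁅_⁆) x U-antichain (proj₂ ∘ proj₂ ∘ xs)

      x∉D : ∀ a b → x a ∉ D b
      x∉D a b x∈Db = x∉∁⁅x⁆ (subst (x a ∈_) (proj₂ (proj₂ (xs a))) (D⊆U a b x∈Db))

      cosingletons-and-singletons⇒⊥ : (∀ b → Singleton (D b)) → Empty
      cosingletons-and-singletons⇒⊥ ys = n≰n∸1 1≤s+t
        (injective⇒≤-bound (x ++ y) (++-injective x-injective y-injective x≢y) (++⁺ Small x-small y-small))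
        where
        open Lowers ys
        x≢y : ∀ a b → x a ≢ y b
        x≢y a b e = x∉D a b (subst (_∈ D b) (sym e) (y∈D b))

      cosingletons-and-keyed-lower⇒⊥ : ∀ {b₀} → Keyed (D b₀) → Empty
      cosingletons-and-keyed-lower⇒⊥ {b₀} M₀ =
        n≰n∸1 1≤t (KeyLantern-antichain-≤-pivot M₀ pivot∈K₀ D lowers-in D-antichain)
        where
        K₀ : Subset n
        K₀ = key M₀
        -- K₀ and the s points x a are disjoint subsets of [s+t] of total size s + t.
        fill : ∀ {i} → elt i ≤ s + t → (∀ a → x a ≢ i) → i ∈ K₀
        fill {i} i≤s+t x≢i with i Sub.∈? K₀
        ... | yes i∈K₀ = i∈K₀
        ... | no i∉K₀ = ⊥-elim (ℕ.1+n≰n (subst (λ k → suc s + k ≤ s + t) (∣key∣≡t M₀)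
                          (count-outside K₀ (i ∷ᶠ x) (∷ᶠ-injective (λ a e → x≢i a (sym e)) x-injective)
                                         avoids-K₀ bounded (key-low M₀))))
          where
          avoids-K₀ : ∀ j → (i ∷ᶠ x) j ∉ K₀
          avoids-K₀ zero = i∉K₀
          avoids-K₀ (suc a) = x∉D a b₀ ∘ key⊆ M₀
          bounded : ∀ j → elt ((i ∷ᶠ x) j) ≤ s + t
          bounded zero = i≤s+t
          bounded (suc a) = small⇒≤ (x-small a)
        pivot∈K₀ : pivot ∈ K₀
        pivot∈K₀ = fill (ℕ.≤-reflexive elt-pivot) (λ a e → pivot-not-small (subst Small e (x-small a)))
        lowers-in : ∀ b → KeyLantern K₀ (D b)
        lowers-in b with lowerShape b
        ... | inj₁ Mb = key⊆⇒KeyLantern Mb (∣key∣≡t M₀) λ i∈ →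
          fill (key-low Mb i∈) (λ a e → x∉D a b (subst (_∈ D b) (sym e) (key⊆ Mb i∈)))
        ... | inj₂ (y , y-small , Db≡⁅y⁆) =
          subst (λ b → KeyLantern K₀ (D b)) (sym (D-antichain b b₀ Db⊆Db₀)) (member M₀)
          where
          y∈Db : y ∈ D b
          y∈Db = subst (y ∈_) (sym Db≡⁅y⁆) (Sub.x∈⁅x⁆ y)
          y∈K₀ : y ∈ K₀
          y∈K₀ = fill (small⇒≤ y-small) (λ a e → x∉D a b (subst (_∈ D b) (sym e) y∈Db))
          Db⊆Db₀ : D b ⊆ D b₀
          Db⊆Db₀ j∈Db rewrite Sub.x∈⁅y⁆⇒x≡y y (subst (_ ∈_) Db≡⁅y⁆ j∈Db) = key⊆ M₀ y∈K₀

    impossible : Empty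
    impossible with some-or-all upperShape | some-or-all lowerShape
    ... | inj₁ (_ , M₀) | inj₁ (_ , Mb) = keyed-upper-covered⇒⊥ M₀ (covered-by-keyed-lower M₀ Mb)
    ... | inj₁ (_ , M₀) | inj₂ ys = keyed-upper-covered⇒⊥ M₀ (Lowers.covered-by-singletons ys M₀)
    ... | inj₂ xs | inj₁ (_ , M₀) = Uppers.cosingletons-and-keyed-lower⇒⊥ xs M₀
    ... | inj₂ xs | inj₂ ys = Uppers.cosingletons-and-singletons⇒⊥ xs ys

lemma3 : (s t n : ℕ) → 2 ≤ t → t ≤ s → 2 * s + t ∸ 1 ≤ n →
    (up low : Subset n → Family n) →
    (∀ A → A ⊆ Itv n 1 (s + t ∸ 1) → ∣ A ∣ ≡ t → IsUpperLantern s t n A (up A)) →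
    (∀ A → A ⊆ Itv n 1 (s + t ∸ 1) → ∣ A ∣ ≡ t ∸ 1 →
      IsLowerLantern s t n (A ∪ Itv n (s + t) (s + t)) (low (A ∪ Itv n (s + t) (s + t)))) →
    ¬ InducedCopy (_≼K_ {s} {t}) (F′ s t n up low)
lemma3 s t n 2≤t t≤s n-large up low up-lantern low-lantern (f , f∈F′ , _ , f-⊆⇔) =
  KstCopy.impossible (f ∘ upper) (f ∘ lower)
    (λ a a′ → to (f-⊆⇔ (upper a) (upper a′)))
    (λ b b′ → to (f-⊆⇔ (lower b) (lower b′)))
    (λ a b → from (f-⊆⇔ (lower b) (upper a)) tt)
    (λ a b → to (f-⊆⇔ (upper a) (lower b)))
    (f∈F′ ∘ upper) (f∈F′ ∘ lower)
  where open Kst-free s t n 2≤t t≤s n-large up low up-lantern low-lantern
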